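{- For nonnegative integers $a_1,\dots,a_n$ let $$h(a_1,\dots,a_n)=\sum_{x_1=1}^{a_1}\sum_{x_2=1}^{a_2x_1}\cdots\sum_{x_n=1}^{a_nx_{n-1}}1 .$$ Then $h$ is given by a polynomial in $a_1,\dots,a_n$ whose only term of highest total degree is $\frac{1}{n!}a_1^na_2^{n-1}a_3^{n-2}\cdots a_n$. This is also true when $h$ is regarded as a polynomial in the single variable $a_1$ (with coefficients polynomials in $a_2,\dots,a_n$): its leading term in $a_1$ is $\frac{1}{n!}a_1^na_2^{n-1}\cdots a_n$. -}

module Defs where

open import Data.Nat as ℕ using (ℕ; zero; suc; _+_; _*_; _∸_; _^_; _!)
open import Data.Nat.Properties using (_!≢0)
open import Data.Integer using (+_)
import Data.Rational as Q
open Q using (ℚ; _/_; 0ℚ)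
open import Data.Fin using (Fin; toℕ)
open import Data.Vec as Vec using (Vec; []; _∷_; tabulate; zipWith)
open import Data.List as List using (List)
open import Data.Product using (_×_; proj₁; proj₂)

sumTo : ℕ → (ℕ → ℕ) → ℕ
sumTo zero    f = 0
sumTo (suc m) f = sumTo m f + f (suc m)

g : ∀ {n} → ℕ → Vec ℕ n → ℕ
g x []       = 1
g x (a ∷ as) = sumTo (a * x) (λ y → g y as)

h : ∀ {n} → Vec ℕ n → ℕ
h as = g 1 as

toℚ : ℕ → ℚ
toℚ m = + m / 1

inv! : ℕ → ℚ
inv! n = (+ 1 / (n !)) {{n !≢0}}

-- a monomial term: coefficient and exponent vector (e_1,...,e_n)
Term : ℕ → Set
Term n = ℚ × Vec ℕ n

deg : ∀ {n} → Vec ℕ n → ℕ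
deg e = Vec.sum e

monoEval : ∀ {n} → Vec ℕ n → Vec ℕ n → ℚ
monoEval a e = toℚ (Vec.foldr _ _*_ 1 (zipWith _^_ a e))

evalPoly : ∀ {n} → List (Term n) → Vec ℕ n → ℚ
evalPoly ts a = List.foldr (λ t acc → proj₁ t Q.* monoEval a (proj₂ t) Q.+ acc) 0ℚ ts

leadExp : (n : ℕ) → Vec ℕ n
leadExp n = tabulate (λ i → n ∸ toℕ i)

module Submission where

-- Write g_m(x; a₁,…,a_m) for the inner sums, so that h(a) = g_n(1; a) and
-- g_{m+1}(x; a, as) = Σ_{y=1}^{a x} g_m(y; as). By induction on m, g_m(x; as) is
-- x^m a₁^m a₂^{m-1} ⋯ a_m / m! plus a combination of monomials x^e a^E with e < m,
-- E₁ = e and total degree of E below that of the leading monomial. The inductive step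
-- needs only Faulhaber's formula Σ_{y=1}^{N} y^e = N^{e+1}/(e+1) + (powers of N below e+1),
-- applied with N = a x. Faulhaber in turn follows from the hockey-stick identity
-- (k+1) Σ_{y=1}^{N} y^{(k)} = N^{(k+1)} for the rising factorials y^{(k)} = y(y+1)⋯(y+k-1),
-- since powers and rising factorials each differ from the other by lower-order terms.

open import Defs
open import Data.Nat as ℕ using (ℕ; zero; suc; _≤_; _<_; z≤n; s≤s)
import Data.Nat.Properties as ℕP
open import Data.Integer as ℤ using (+_)
import Data.Integer.Properties as ℤP
open import Data.Rational as ℚ using (ℚ; 0ℚ; 1ℚ; _+_; _*_; -_; _/_)
import Data.Rational.Properties as ℚP
import Data.Rational.Unnormalised as ℚᵘ
import Data.Rational.Unnormalised.Properties as ℚᵘP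
open import Algebra.Bundles using (CommutativeRing)
open import Algebra.Properties.CommutativeSemiring.Exp
  (CommutativeRing.commutativeSemiring ℚP.+-*-commutativeRing) using (_^_; ^-distrib-*)
open import Data.Rational.Solver using (module +-*-Solver)
open import Data.Vec using (Vec; []; _∷_; lookup)
open import Data.Fin using (fromℕ<)
open import Data.List using (List; []; _∷_; _++_; map)
open import Data.List.Relation.Unary.All as All using (All; []; _∷_)
open import Data.List.Relation.Unary.All.Properties using (++⁺; map⁺)
open import Data.Product using (Σ; Σ-syntax; _×_; _,_; proj₁; proj₂)
open import Function using (_∘_)
open import Relation.Binary.PropositionalEquality
  using (_≡_; _≗_; refl; sym; trans; cong; cong₂; module ≡-Reasoning)

open +-*-Solver using (solve; _:+_; _:*_; :-_; _:=_; con)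

fromℚᵘ-homo-+ : ∀ p q → ℚ.fromℚᵘ (p ℚᵘ.+ q) ≡ ℚ.fromℚᵘ p + ℚ.fromℚᵘ q
fromℚᵘ-homo-+ p q = begin
  ℚ.fromℚᵘ (p ℚᵘ.+ q)
    ≡⟨ ℚP.fromℚᵘ-cong (ℚᵘP.+-cong (ℚᵘP.≃-sym (ℚP.toℚᵘ-fromℚᵘ p)) (ℚᵘP.≃-sym (ℚP.toℚᵘ-fromℚᵘ q))) ⟩
  ℚ.fromℚᵘ (ℚ.toℚᵘ (ℚ.fromℚᵘ p) ℚᵘ.+ ℚ.toℚᵘ (ℚ.fromℚᵘ q))
    ≡⟨ ℚP.fromℚᵘ-cong (ℚᵘP.≃-sym (ℚP.toℚᵘ-homo-+ (ℚ.fromℚᵘ p) (ℚ.fromℚᵘ q))) ⟩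
  ℚ.fromℚᵘ (ℚ.toℚᵘ (ℚ.fromℚᵘ p + ℚ.fromℚᵘ q))
    ≡⟨ ℚP.fromℚᵘ-toℚᵘ _ ⟩
  ℚ.fromℚᵘ p + ℚ.fromℚᵘ q ∎
  where open ≡-Reasoning

fromℚᵘ-homo-* : ∀ p q → ℚ.fromℚᵘ (p ℚᵘ.* q) ≡ ℚ.fromℚᵘ p * ℚ.fromℚᵘ q
fromℚᵘ-homo-* p q = begin
  ℚ.fromℚᵘ (p ℚᵘ.* q)
    ≡⟨ ℚP.fromℚᵘ-cong (ℚᵘP.*-cong (ℚᵘP.≃-sym (ℚP.toℚᵘ-fromℚᵘ p)) (ℚᵘP.≃-sym (ℚP.toℚᵘ-fromℚᵘ q))) ⟩
  ℚ.fromℚᵘ (ℚ.toℚᵘ (ℚ.fromℚᵘ p) ℚᵘ.* ℚ.toℚᵘ (ℚ.fromℚᵘ q))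
    ≡⟨ ℚP.fromℚᵘ-cong (ℚᵘP.≃-sym (ℚP.toℚᵘ-homo-* (ℚ.fromℚᵘ p) (ℚ.fromℚᵘ q))) ⟩
  ℚ.fromℚᵘ (ℚ.toℚᵘ (ℚ.fromℚᵘ p * ℚ.fromℚᵘ q))
    ≡⟨ ℚP.fromℚᵘ-toℚᵘ _ ⟩
  ℚ.fromℚᵘ p * ℚ.fromℚᵘ q ∎
  where open ≡-Reasoning

-- toℚ m is definitionally fromℚᵘ (mkℚᵘ (+ m) 0), so the homomorphism lemmas above apply.
toℚ-+ : ∀ m n → toℚ (m ℕ.+ n) ≡ toℚ m + toℚ n
toℚ-+ m n = trans (ℚP.fromℚᵘ-cong m+n≃) (fromℚᵘ-homo-+ (ℚᵘ.mkℚᵘ (+ m) 0) (ℚᵘ.mkℚᵘ (+ n) 0))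
  where
  m+n≃ : ℚᵘ.mkℚᵘ (+ (m ℕ.+ n)) 0 ℚᵘ.≃ ℚᵘ.mkℚᵘ (+ m) 0 ℚᵘ.+ ℚᵘ.mkℚᵘ (+ n) 0
  m+n≃ = ℚᵘ.*≡* (cong (ℤ._* + 1)
    (trans (ℤP.pos-+ m n) (sym (cong₂ ℤ._+_ (ℤP.*-identityʳ (+ m)) (ℤP.*-identityʳ (+ n))))))

toℚ-* : ∀ m n → toℚ (m ℕ.* n) ≡ toℚ m * toℚ n
toℚ-* m n = trans (ℚP.fromℚᵘ-cong m*n≃) (fromℚᵘ-homo-* (ℚᵘ.mkℚᵘ (+ m) 0) (ℚᵘ.mkℚᵘ (+ n) 0))
  where
  m*n≃ : ℚᵘ.mkℚᵘ (+ (m ℕ.* n)) 0 ℚᵘ.≃ ℚᵘ.mkℚᵘ (+ m) 0 ℚᵘ.* ℚᵘ.mkℚᵘ (+ n) 0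
  m*n≃ = ℚᵘ.*≡* (cong (ℤ._* + 1) (ℤP.pos-* m n))

toℚ*1/n : ∀ n .{{_ : ℕ.NonZero n}} → toℚ n * (+ 1 / n) ≡ 1ℚ
toℚ*1/n (suc d) = trans (sym (fromℚᵘ-homo-* p (ℚᵘ.1/ p))) (ℚP.fromℚᵘ-cong (ℚᵘP.*-inverseʳ p))
  where p = ℚᵘ.mkℚᵘ (+ suc d) 0

toℚ-suc : ∀ m → toℚ (suc m) ≡ 1ℚ + toℚ m
toℚ-suc = toℚ-+ 1

toℚ-^ : ∀ m k → toℚ (m ℕ.^ k) ≡ toℚ m ^ k
toℚ-^ m zero    = refl
toℚ-^ m (suc k) = trans (toℚ-* m (m ℕ.^ k)) (cong (toℚ m *_) (toℚ-^ m k))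

toℚ1^k≡1 : ∀ k → toℚ 1 ^ k ≡ 1ℚ
toℚ1^k≡1 k = trans (sym (toℚ-^ 1 k)) (cong toℚ (ℕP.^-zeroˡ k))

*-inverse-unique : ∀ {x y z} → x * y ≡ 1ℚ → x * z ≡ 1ℚ → y ≡ z
*-inverse-unique {x} {y} {z} xy≡1 xz≡1 = begin
  y              ≡⟨ ℚP.*-identityˡ y ⟨
  1ℚ * y         ≡⟨ cong (_* y) xz≡1 ⟨
  x * z * y      ≡⟨ solve 3 (λ x y z → x :* z :* y := x :* y :* z) refl x y z ⟩
  x * y * z      ≡⟨ cong (_* z) xy≡1 ⟩
  1ℚ * z         ≡⟨ ℚP.*-identityˡ z ⟩
  z              ∎
  where open ≡-Reasoning

inv!-suc : ∀ m → inv! (suc m) ≡ inv! m * (+ 1 / suc m)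
inv!-suc m = *-inverse-unique {toℚ (suc m ℕ.!)} (toℚ*1/n (suc m ℕ.!) {{suc m ℕP.!≢0}}) (begin
  toℚ (suc m ℕ.* m ℕ.!) * (inv! m * (+ 1 / suc m))
    ≡⟨ cong (_* (inv! m * (+ 1 / suc m))) (toℚ-* (suc m) (m ℕ.!)) ⟩
  toℚ (suc m) * toℚ (m ℕ.!) * (inv! m * (+ 1 / suc m))
    ≡⟨ solve 4 (λ s f i j → s :* f :* (i :* j) := f :* i :* (s :* j))
               refl (toℚ (suc m)) (toℚ (m ℕ.!)) (inv! m) (+ 1 / suc m) ⟩
  toℚ (m ℕ.!) * inv! m * (toℚ (suc m) * (+ 1 / suc m))
    ≡⟨ cong₂ _*_ (toℚ*1/n (m ℕ.!) {{m ℕP.!≢0}}) (toℚ*1/n (suc m)) ⟩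
  1ℚ ∎)
  where open ≡-Reasoning

sumToℚ : ℕ → (ℕ → ℚ) → ℚ
sumToℚ zero    f = 0ℚ
sumToℚ (suc N) f = sumToℚ N f + f (suc N)

toℚ-sumTo : ∀ N f → toℚ (sumTo N f) ≡ sumToℚ N (toℚ ∘ f)
toℚ-sumTo zero    f = refl
toℚ-sumTo (suc N) f = trans (toℚ-+ (sumTo N f) (f (suc N))) (cong (_+ toℚ (f (suc N))) (toℚ-sumTo N f))

sumToℚ-cong : ∀ N {f g} → f ≗ g → sumToℚ N f ≡ sumToℚ N g
sumToℚ-cong zero    f≗g = refl
sumToℚ-cong (suc N) f≗g = cong₂ _+_ (sumToℚ-cong N f≗g) (f≗g (suc N))

sumToℚ-zero : ∀ N → sumToℚ N (λ _ → 0ℚ) ≡ 0ℚ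
sumToℚ-zero zero    = refl
sumToℚ-zero (suc N) = trans (ℚP.+-identityʳ _) (sumToℚ-zero N)

sumToℚ-+ : ∀ N f g → sumToℚ N (λ y → f y + g y) ≡ sumToℚ N f + sumToℚ N g
sumToℚ-+ zero    f g = refl
sumToℚ-+ (suc N) f g = begin
  sumToℚ N (λ y → f y + g y) + (f (suc N) + g (suc N))
    ≡⟨ cong (_+ (f (suc N) + g (suc N))) (sumToℚ-+ N f g) ⟩
  sumToℚ N f + sumToℚ N g + (f (suc N) + g (suc N))
    ≡⟨ solve 4 (λ a b c d → a :+ b :+ (c :+ d) := a :+ c :+ (b :+ d))
               refl (sumToℚ N f) (sumToℚ N g) (f (suc N)) (g (suc N)) ⟩
  sumToℚ N f + f (suc N) + (sumToℚ N g + g (suc N)) ∎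
  where open ≡-Reasoning

sumToℚ-*ˡ : ∀ N c f → sumToℚ N (λ y → c * f y) ≡ c * sumToℚ N f
sumToℚ-*ˡ zero    c f = sym (ℚP.*-zeroʳ c)
sumToℚ-*ˡ (suc N) c f =
  trans (cong (_+ c * f (suc N)) (sumToℚ-*ˡ N c f)) (sym (ℚP.*-distribˡ-+ c (sumToℚ N f) (f (suc N))))

module _ {I : Set} where

  lincomb : (I → ℚ) → List (ℚ × I) → ℚ
  lincomb v []            = 0ℚ
  lincomb v ((c , i) ∷ L) = c * v i + lincomb v L

  scale : ℚ → List (ℚ × I) → List (ℚ × I)
  scale c = map (λ (d , i) → (c * d , i))

  lincomb-cong : ∀ {v w} → v ≗ w → ∀ L → lincomb v L ≡ lincomb w L
  lincomb-cong v≗w []            = refl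
  lincomb-cong v≗w ((c , i) ∷ L) = cong₂ (λ x y → c * x + y) (v≗w i) (lincomb-cong v≗w L)

  lincomb-++ : ∀ v L K → lincomb v (L ++ K) ≡ lincomb v L + lincomb v K
  lincomb-++ v []            K = sym (ℚP.+-identityˡ _)
  lincomb-++ v ((c , i) ∷ L) K =
    trans (cong (_+_ (c * v i)) (lincomb-++ v L K)) (sym (ℚP.+-assoc (c * v i) _ _))

  lincomb-scale : ∀ v c L → lincomb v (scale c L) ≡ c * lincomb v L
  lincomb-scale v c []            = sym (ℚP.*-zeroʳ c)
  lincomb-scale v c ((d , i) ∷ L) = begin
    c * d * v i + lincomb v (scale c L)
      ≡⟨ cong (_+_ (c * d * v i)) (lincomb-scale v c L) ⟩
    c * d * v i + c * lincomb v L
      ≡⟨ solve 4 (λ c d x y → c :* d :* x :+ c :* y := c :* (d :* x :+ y)) refl c d (v i) (lincomb v L) ⟩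
    c * (d * v i + lincomb v L) ∎
    where open ≡-Reasoning

  *-lincomb : ∀ v c L → c * lincomb v L ≡ lincomb (λ i → c * v i) L
  *-lincomb v c []            = ℚP.*-zeroʳ c
  *-lincomb v c ((d , i) ∷ L) = begin
    c * (d * v i + lincomb v L)
      ≡⟨ solve 4 (λ c d x y → c :* (d :* x :+ y) := d :* (c :* x) :+ c :* y) refl c d (v i) (lincomb v L) ⟩
    d * (c * v i) + c * lincomb v L
      ≡⟨ cong (_+_ (d * (c * v i))) (*-lincomb v c L) ⟩
    d * (c * v i) + lincomb (λ i → c * v i) L ∎
    where open ≡-Reasoning

  sumToℚ-lincomb : ∀ N (v : ℕ → I → ℚ) L →
    sumToℚ N (λ y → lincomb (v y) L) ≡ lincomb (λ i → sumToℚ N (λ y → v y i)) L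
  sumToℚ-lincomb N v []            = sumToℚ-zero N
  sumToℚ-lincomb N v ((c , i) ∷ L) = begin
    sumToℚ N (λ y → c * v y i + lincomb (v y) L)
      ≡⟨ sumToℚ-+ N (λ y → c * v y i) (λ y → lincomb (v y) L) ⟩
    sumToℚ N (λ y → c * v y i) + sumToℚ N (λ y → lincomb (v y) L)
      ≡⟨ cong₂ _+_ (sumToℚ-*ˡ N c (λ y → v y i)) (sumToℚ-lincomb N v L) ⟩
    c * sumToℚ N (λ y → v y i) + lincomb (λ i → sumToℚ N (λ y → v y i)) L ∎
    where open ≡-Reasoning

Span : {A I : Set} → (I → A → ℚ) → (I → Set) → (A → ℚ) → Set
Span {A} {I} b P f = Σ[ L ∈ List (ℚ × I) ] All (P ∘ proj₂) L × (∀ x → f x ≡ lincomb (λ i → b i x) L)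

module _ {A I : Set} {b : I → A → ℚ} where

  span-0 : ∀ {P} → Span b P (λ _ → 0ℚ)
  span-0 = [] , [] , λ _ → refl

  span-basis : ∀ {P i} → P i → Span b P (b i)
  span-basis {i = i} p =
    (1ℚ , i) ∷ [] , p ∷ [] , λ x → sym (trans (ℚP.+-identityʳ _) (ℚP.*-identityˡ (b i x)))

  span-cong : ∀ {P f g} → f ≗ g → Span b P f → Span b P g
  span-cong f≗g (L , L∈P , f≗L) = L , L∈P , λ x → trans (sym (f≗g x)) (f≗L x)

  span-mono : ∀ {P Q f} → (∀ {i} → P i → Q i) → Span b P f → Span b Q f
  span-mono P⊆Q (L , L∈P , f≗L) = L , All.map P⊆Q L∈P , f≗L

  span-+ : ∀ {P f g} → Span b P f → Span b P g → Span b P (λ x → f x + g x)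
  span-+ (L , L∈P , f≗L) (K , K∈P , g≗K) =
    L ++ K , ++⁺ L∈P K∈P , λ x → trans (cong₂ _+_ (f≗L x) (g≗K x)) (sym (lincomb-++ (λ i → b i x) L K))

  span-*ˡ : ∀ {P f} c → Span b P f → Span b P (λ x → c * f x)
  span-*ˡ c (L , L∈P , f≗L) =
    scale c L , map⁺ L∈P , λ x → trans (cong (c *_) (f≗L x)) (sym (lincomb-scale (λ i → b i x) c L))

  span-lincomb : ∀ {J P} {Q : J → Set} (φ : J → A → ℚ) → (∀ {j} → Q j → Span b P (φ j)) →
    ∀ L → All (Q ∘ proj₂) L → Span b P (λ x → lincomb (λ j → φ j x) L)
  span-lincomb φ φ∈ []            []          = span-0
  span-lincomb φ φ∈ ((c , j) ∷ L) (q ∷ L∈Q) = span-+ (span-*ˡ c (φ∈ q)) (span-lincomb φ φ∈ L L∈Q)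

span-*X : ∀ {I} {b : I → ℚ → ℚ} {P Q f} → (∀ {i} → P i → Span b Q (λ y → y * b i y)) →
  Span b P f → Span b Q (λ y → y * f y)
span-*X {b = b} y*b∈ (L , L∈P , f≗L) =
  span-cong (λ y → sym (trans (cong (y *_) (f≗L y)) (*-lincomb (λ i → b i y) y L)))
            (span-lincomb (λ i y → y * b i y) y*b∈ L L∈P)

Poly< : ℕ → (ℚ → ℚ) → Set
Poly< d = Span (λ k X → X ^ k) (_< d)

poly-*X : ∀ {d f} → Poly< d f → Poly< (suc d) (λ X → X * f X)
poly-*X = span-*X (λ k<d → span-basis (s≤s k<d))

rising : ℕ → ℚ → ℚ
rising zero    y = 1ℚ
rising (suc k) y = rising k y * (y + toℚ k)

rising-expansion : ∀ k → Σ[ p ∈ (ℚ → ℚ) ] Poly< k p × (∀ X → rising k X ≡ X ^ k + p X)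
rising-expansion zero    = (λ _ → 0ℚ) , span-0 , λ _ → refl
rising-expansion (suc k) =
  let (p , p∈ , p-eq) = rising-expansion k in
  (λ X → toℚ k * X ^ k + (X * p X + toℚ k * p X)) ,
  span-+ (span-*ˡ (toℚ k) (span-basis (ℕP.n<1+n k)))
         (span-+ (poly-*X p∈) (span-*ˡ (toℚ k) (span-mono ℕP.m<n⇒m<1+n p∈))) ,
  λ X → trans (cong (_* (X + toℚ k)) (p-eq X))
              (solve 4 (λ x t q r → (q :+ r) :* (x :+ t) := x :* q :+ (t :* q :+ (x :* r :+ t :* r)))
                       refl X (toℚ k) (X ^ k) (p X))

rising∈poly : ∀ k → Poly< (suc k) (rising k)
rising∈poly k =
  let (p , p∈ , p-eq) = rising-expansion k in
  span-cong (sym ∘ p-eq) (span-+ (span-basis ℕP.≤-refl) (span-mono ℕP.m<n⇒m<1+n p∈))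

span-rising⇒poly : ∀ {d f} → Span rising (_< d) f → Poly< d f
span-rising⇒poly (L , L∈ , f≗L) =
  span-cong (sym ∘ f≗L)
    (span-lincomb rising (λ {k} k<d → span-mono (λ i<1+k → ℕP.<-≤-trans i<1+k k<d) (rising∈poly k)) L L∈)

span-rising-*X : ∀ {d f} → Span rising (_< d) f → Span rising (_< suc d) (λ y → y * f y)
span-rising-*X = span-*X λ {k} k<d →
  span-cong (λ y → solve 3 (λ y t r → r :* (y :+ t) :+ (:- t) :* r := y :* r) refl y (toℚ k) (rising k y))
            (span-+ (span-basis (s≤s k<d)) (span-*ˡ (- toℚ k) (span-basis (ℕP.m<n⇒m<1+n k<d))))

power-rising-expansion : ∀ e → Σ[ p ∈ (ℚ → ℚ) ] Span rising (_< e) p × (∀ y → y ^ e ≡ rising e y + p y)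
power-rising-expansion zero    = (λ _ → 0ℚ) , span-0 , λ _ → refl
power-rising-expansion (suc e) =
  let (p , p∈ , p-eq) = power-rising-expansion e in
  (λ y → - toℚ e * rising e y + y * p y) ,
  span-+ (span-*ˡ (- toℚ e) (span-basis (ℕP.n<1+n e))) (span-rising-*X p∈) ,
  λ y → trans (cong (y *_) (p-eq y))
              (solve 4 (λ y t r q → y :* (r :+ q) := r :* (y :+ t) :+ ((:- t) :* r :+ y :* q))
                       refl y (toℚ e) (rising e y) (p y))

rising-shift : ∀ k y → rising k (1ℚ + y) * y ≡ rising (suc k) y
rising-shift zero    y = solve 1 (λ y → con 1ℚ :* y := con 1ℚ :* (y :+ con 0ℚ)) refl y
rising-shift (suc k) y = begin
  rising k (1ℚ + y) * (1ℚ + y + toℚ k) * y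
    ≡⟨ solve 3 (λ r y t → r :* (con 1ℚ :+ y :+ t) :* y := r :* y :* (y :+ (con 1ℚ :+ t)))
               refl (rising k (1ℚ + y)) y (toℚ k) ⟩
  rising k (1ℚ + y) * y * (y + (1ℚ + toℚ k))
    ≡⟨ cong₂ (λ r t → r * (y + t)) (rising-shift k y) (sym (toℚ-suc k)) ⟩
  rising (suc k) y * (y + toℚ (suc k)) ∎
  where open ≡-Reasoning

rising-difference : ∀ k y → rising (suc k) (1ℚ + y) ≡ rising (suc k) y + toℚ (suc k) * rising k (1ℚ + y)
rising-difference k y = begin
  rising k (1ℚ + y) * (1ℚ + y + toℚ k)
    ≡⟨ solve 3 (λ r y t → r :* (con 1ℚ :+ y :+ t) := r :* y :+ (con 1ℚ :+ t) :* r)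
               refl (rising k (1ℚ + y)) y (toℚ k) ⟩
  rising k (1ℚ + y) * y + (1ℚ + toℚ k) * rising k (1ℚ + y)
    ≡⟨ cong₂ (λ r t → r + t * rising k (1ℚ + y)) (rising-shift k y) (sym (toℚ-suc k)) ⟩
  rising (suc k) y + toℚ (suc k) * rising k (1ℚ + y) ∎
  where open ≡-Reasoning

rising-suc-0 : ∀ k → rising (suc k) 0ℚ ≡ 0ℚ
rising-suc-0 zero    = refl
rising-suc-0 (suc k) = trans (cong (_* (0ℚ + toℚ (suc k))) (rising-suc-0 k)) (ℚP.*-zeroˡ (0ℚ + toℚ (suc k)))

hockey-stick : ∀ k N → toℚ (suc k) * sumToℚ N (rising k ∘ toℚ) ≡ rising (suc k) (toℚ N)
hockey-stick k zero    = trans (ℚP.*-zeroʳ (toℚ (suc k))) (sym (rising-suc-0 k))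
hockey-stick k (suc N) = begin
  toℚ (suc k) * (sumToℚ N (rising k ∘ toℚ) + rising k (toℚ (suc N)))
    ≡⟨ ℚP.*-distribˡ-+ (toℚ (suc k)) _ _ ⟩
  toℚ (suc k) * sumToℚ N (rising k ∘ toℚ) + toℚ (suc k) * rising k (toℚ (suc N))
    ≡⟨ cong₂ (λ s r → s + toℚ (suc k) * rising k r) (hockey-stick k N) (toℚ-suc N) ⟩
  rising (suc k) (toℚ N) + toℚ (suc k) * rising k (1ℚ + toℚ N)
    ≡⟨ rising-difference k (toℚ N) ⟨
  rising (suc k) (1ℚ + toℚ N)
    ≡⟨ cong (rising (suc k)) (toℚ-suc N) ⟨
  rising (suc k) (toℚ (suc N)) ∎
  where open ≡-Reasoning

sum-rising : ∀ k N → sumToℚ N (rising k ∘ toℚ) ≡ + 1 / suc k * rising (suc k) (toℚ N)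
sum-rising k N = begin
  S                                       ≡⟨ ℚP.*-identityˡ S ⟨
  1ℚ * S                                  ≡⟨ cong (_* S) (trans (ℚP.*-comm (+ 1 / suc k) (toℚ (suc k))) (toℚ*1/n (suc k))) ⟨
  + 1 / suc k * toℚ (suc k) * S           ≡⟨ ℚP.*-assoc (+ 1 / suc k) (toℚ (suc k)) S ⟩
  + 1 / suc k * (toℚ (suc k) * S)         ≡⟨ cong (+ 1 / suc k *_) (hockey-stick k N) ⟩
  + 1 / suc k * rising (suc k) (toℚ N)    ∎
  where
  open ≡-Reasoning
  S = sumToℚ N (rising k ∘ toℚ)

sum-span-rising : ∀ {d f} → Span rising (_< d) f →
  Σ[ F ∈ (ℚ → ℚ) ] Span rising (_< suc d) F × (∀ N → sumToℚ N (f ∘ toℚ) ≡ F (toℚ N))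
sum-span-rising (L , L∈ , f≗L) =
  (λ y → lincomb (λ k → φ k y) L) ,
  span-lincomb φ (λ {k} k<d → span-*ˡ (+ 1 / suc k) (span-basis (s≤s k<d))) L L∈ ,
  λ N → trans (sumToℚ-cong N (f≗L ∘ toℚ))
       (trans (sumToℚ-lincomb N (λ y k → rising k (toℚ y)) L)
              (lincomb-cong (λ k → sum-rising k N) L))
  where
  φ : ℕ → ℚ → ℚ
  φ k y = + 1 / suc k * rising (suc k) y

FaulhaberRemainder : ℕ → (ℚ → ℚ) → Set
FaulhaberRemainder e p = ∀ N → sumToℚ N (λ y → toℚ y ^ e) ≡ + 1 / suc e * toℚ N ^ suc e + p (toℚ N)

faulhaber : ∀ e → Σ[ p ∈ (ℚ → ℚ) ] Poly< (suc e) p × FaulhaberRemainder e p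
faulhaber e =
  let (r , r∈ , r-eq) = power-rising-expansion e
      (F , F∈ , F-eq) = sum-span-rising r∈
      (q , q∈ , q-eq) = rising-expansion (suc e)
      c = + 1 / suc e
  in
  (λ X → c * q X + F X) ,
  span-+ (span-*ˡ c q∈) (span-rising⇒poly F∈) ,
  λ N → let open ≡-Reasoning; X = toℚ N in begin
    sumToℚ N (λ y → toℚ y ^ e)
      ≡⟨ sumToℚ-cong N (r-eq ∘ toℚ) ⟩
    sumToℚ N (λ y → rising e (toℚ y) + r (toℚ y))
      ≡⟨ sumToℚ-+ N (rising e ∘ toℚ) (r ∘ toℚ) ⟩
    sumToℚ N (rising e ∘ toℚ) + sumToℚ N (r ∘ toℚ)
      ≡⟨ cong₂ _+_ (trans (sum-rising e N) (cong (c *_) (q-eq X))) (F-eq N) ⟩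
    c * (X ^ suc e + q X) + F X
      ≡⟨ solve 4 (λ c x q f → c :* (x :+ q) :+ f := c :* x :+ (c :* q :+ f)) refl c (X ^ suc e) (q X) (F X) ⟩
    c * X ^ suc e + (c * q X + F X) ∎

-- x enters g only through the product a₁x, so every monomial x^e a^E of g_m has e = E₁;
-- xdeg reads that exponent off E (for m = 0 the junk value 0 is never used).
xdeg : ∀ {m} → Vec ℕ m → ℕ
xdeg []      = 0
xdeg (e ∷ _) = e

monomial : ∀ {m} → Vec ℕ m → ℕ × Vec ℕ m → ℚ
monomial E (x , as) = toℚ x ^ xdeg E * monoEval as E

LowerOrder : ∀ m → Vec ℕ m → Set
LowerOrder m E = xdeg E < m × deg E < deg (leadExp m)

nestSum : ∀ {m} → (ℕ × Vec ℕ m → ℚ) → ℕ × Vec ℕ (suc m) → ℚ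
nestSum f (x , a ∷ as) = sumToℚ (a ℕ.* x) (λ y → f (y , as))

monoEval-∷ : ∀ {m} a (as : Vec ℕ m) k E → monoEval (a ∷ as) (k ∷ E) ≡ toℚ a ^ k * monoEval as E
monoEval-∷ a as k E = trans (toℚ-* (a ℕ.^ k) _) (cong (_* monoEval as E) (toℚ-^ a k))

liftPoly : ∀ {m} → Vec ℕ m → (ℚ → ℚ) → ℕ × Vec ℕ (suc m) → ℚ
liftPoly E q (x , a ∷ as) = monoEval as E * q (toℚ a * toℚ x)

span-liftPoly : ∀ {m B q} (E : Vec ℕ m) → Poly< B q → B ≤ suc m → deg E ≤ deg (leadExp m) →
  Span monomial (LowerOrder (suc m)) (liftPoly E q)
span-liftPoly {m} {B} {q} E (L , L∈ , q≗L) B≤1+m degE≤ =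
  span-cong eq (span-lincomb (λ k → monomial (k ∷ E)) (λ k<B → span-basis (lower k<B)) L L∈)
  where
  lower : ∀ {k} → k < B → LowerOrder (suc m) (k ∷ E)
  lower k<B = k<1+m , ℕP.+-mono-<-≤ k<1+m degE≤
    where k<1+m = ℕP.<-≤-trans k<B B≤1+m

  eq : ∀ z → lincomb (λ k → monomial (k ∷ E) z) L ≡ liftPoly E q z
  eq (x , a ∷ as) = begin
    lincomb (λ k → X ^ k * monoEval (a ∷ as) (k ∷ E)) L
      ≡⟨ lincomb-cong term L ⟩
    lincomb (λ k → M * (A * X) ^ k) L
      ≡⟨ *-lincomb ((A * X) ^_) M L ⟨
    M * lincomb ((A * X) ^_) L
      ≡⟨ cong (M *_) (q≗L (A * X)) ⟨
    M * q (A * X) ∎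
    where
    open ≡-Reasoning
    X = toℚ x
    A = toℚ a
    M = monoEval as E
    term : ∀ k → X ^ k * monoEval (a ∷ as) (k ∷ E) ≡ M * (A * X) ^ k
    term k = begin
      X ^ k * monoEval (a ∷ as) (k ∷ E)  ≡⟨ cong (X ^ k *_) (monoEval-∷ a as k E) ⟩
      X ^ k * (A ^ k * M)                ≡⟨ solve 3 (λ x y m → x :* (y :* m) := m :* (y :* x)) refl (X ^ k) (A ^ k) M ⟩
      M * (A ^ k * X ^ k)                ≡⟨ cong (M *_) (^-distrib-* A X k) ⟨
      M * (A * X) ^ k                    ∎

nestSum-monomial : ∀ {m p} (E : Vec ℕ m) → FaulhaberRemainder (xdeg E) p →
  ∀ z → liftPoly E (λ X → + 1 / suc (xdeg E) * X ^ suc (xdeg E) + p X) z ≡ nestSum (monomial E) z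
nestSum-monomial {p = p} E p-eq (x , a ∷ as) = begin
  M * F (toℚ a * toℚ x)            ≡⟨ cong (λ Y → M * F Y) (toℚ-* a x) ⟨
  M * F (toℚ N)                    ≡⟨ cong (M *_) (p-eq N) ⟨
  M * sumToℚ N (λ y → toℚ y ^ e)   ≡⟨ sumToℚ-*ˡ N M (λ y → toℚ y ^ e) ⟨
  sumToℚ N (λ y → M * toℚ y ^ e)   ≡⟨ sumToℚ-cong N (λ y → ℚP.*-comm M (toℚ y ^ e)) ⟩
  sumToℚ N (λ y → toℚ y ^ e * M)   ∎
  where
  open ≡-Reasoning
  e = xdeg E
  F = λ X → + 1 / suc e * X ^ suc e + p X
  M = monoEval as E
  N = a ℕ.* x

sum-monomial : ∀ {m} {E : Vec ℕ m} → LowerOrder m E → Span monomial (LowerOrder (suc m)) (nestSum (monomial E))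
sum-monomial {m} {E} (e<m , degE<) =
  let (p , p∈ , p-eq) = faulhaber e
      F∈ = span-+ (span-*ˡ (+ 1 / suc e) (span-basis (ℕP.n<1+n (suc e)))) (span-mono ℕP.m<n⇒m<1+n p∈)
  in span-cong (nestSum-monomial E p-eq) (span-liftPoly {B = suc (suc e)} E F∈ (s≤s e<m) (ℕP.<⇒≤ degE<))
  where e = xdeg E

sum-lower : ∀ {m f} → Span monomial (LowerOrder m) f → Span monomial (LowerOrder (suc m)) (nestSum f)
sum-lower {f = f} (T , T∈ , f≗T) =
  span-cong eq (span-lincomb (nestSum ∘ monomial) (λ {E} → sum-monomial {E = E}) T T∈)
  where
  eq : ∀ z → lincomb (λ E → nestSum (monomial E) z) T ≡ nestSum f z
  eq (x , a ∷ as) = sym (trans (sumToℚ-cong (a ℕ.* x) (λ y → f≗T (y , as)))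
                               (sumToℚ-lincomb (a ℕ.* x) (λ y E → monomial E (y , as)) T))

sum-leading : ∀ {m p} → FaulhaberRemainder m p → ∀ a x (as : Vec ℕ m) →
  sumToℚ (a ℕ.* x) (λ y → inv! m * toℚ y ^ m * monoEval as (leadExp m)) ≡
  inv! (suc m) * toℚ x ^ suc m * monoEval (a ∷ as) (leadExp (suc m)) +
  inv! m * liftPoly (leadExp m) p (x , a ∷ as)
sum-leading {m} {p} p-eq a x as = begin
  sumToℚ N (λ y → I * toℚ y ^ m * M)
    ≡⟨ sumToℚ-cong N (λ y → solve 3 (λ i y m → i :* y :* m := i :* m :* y) refl I (toℚ y ^ m) M) ⟩
  sumToℚ N (λ y → I * M * toℚ y ^ m)
    ≡⟨ sumToℚ-*ˡ N (I * M) (λ y → toℚ y ^ m) ⟩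
  I * M * sumToℚ N (λ y → toℚ y ^ m)
    ≡⟨ cong (I * M *_) (trans (p-eq N) (cong (λ Y → c * Y ^ suc m + p Y) (toℚ-* a x))) ⟩
  I * M * (c * (A * X) ^ suc m + p (A * X))
    ≡⟨ cong (λ Y → I * M * (c * Y + p (A * X))) (^-distrib-* A X (suc m)) ⟩
  I * M * (c * (A ^ suc m * X ^ suc m) + p (A * X))
    ≡⟨ solve 6 (λ i m c a x q → i :* m :* (c :* (a :* x) :+ q) := i :* c :* x :* (a :* m) :+ i :* (m :* q))
               refl I M c (A ^ suc m) (X ^ suc m) (p (A * X)) ⟩
  I * c * X ^ suc m * (A ^ suc m * M) + I * (M * p (A * X))
    ≡⟨ cong₂ (λ i u → i * X ^ suc m * u + I * (M * p (A * X)))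
             (inv!-suc m) (monoEval-∷ a as (suc m) (leadExp m)) ⟨
  inv! (suc m) * X ^ suc m * monoEval (a ∷ as) (leadExp (suc m)) + I * (M * p (A * X)) ∎
  where
  open ≡-Reasoning
  N = a ℕ.* x
  X = toℚ x
  A = toℚ a
  I = inv! m
  M = monoEval as (leadExp m)
  c = + 1 / suc m

Expansion : ∀ m → (ℕ × Vec ℕ m → ℚ) → Set
Expansion m f = Span monomial (LowerOrder m) f ×
  (∀ x as → toℚ (g x as) ≡ inv! m * toℚ x ^ m * monoEval as (leadExp m) + f (x , as))

expansion-suc : ∀ {m p f} → Poly< (suc m) p → FaulhaberRemainder m p → Expansion m f →
  Expansion (suc m) (λ z → inv! m * liftPoly (leadExp m) p z + nestSum f z)
expansion-suc {m} {p} {f} p∈ p-eq (f∈ , g-eq) =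
  span-+ (span-*ˡ (inv! m) (span-liftPoly {B = suc m} (leadExp m) p∈ ℕP.≤-refl ℕP.≤-refl))
         (sum-lower f∈) ,
  eq
  where
  eq : ∀ x as → toℚ (g x as) ≡ inv! (suc m) * toℚ x ^ suc m * monoEval as (leadExp (suc m)) +
                                (inv! m * liftPoly (leadExp m) p (x , as) + nestSum f (x , as))
  eq x (a ∷ as) = begin
    toℚ (sumTo N (λ y → g y as))
      ≡⟨ toℚ-sumTo N (λ y → g y as) ⟩
    sumToℚ N (λ y → toℚ (g y as))
      ≡⟨ sumToℚ-cong N (λ y → g-eq y as) ⟩
    sumToℚ N (λ y → inv! m * toℚ y ^ m * monoEval as (leadExp m) + f (y , as))
      ≡⟨ sumToℚ-+ N (λ y → inv! m * toℚ y ^ m * monoEval as (leadExp m)) (λ y → f (y , as)) ⟩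
    sumToℚ N (λ y → inv! m * toℚ y ^ m * monoEval as (leadExp m)) + nestSum f (x , a ∷ as)
      ≡⟨ cong (_+ nestSum f (x , a ∷ as)) (sum-leading {p = p} p-eq a x as) ⟩
    leading + rest + nestSum f (x , a ∷ as)
      ≡⟨ ℚP.+-assoc leading rest (nestSum f (x , a ∷ as)) ⟩
    leading + (rest + nestSum f (x , a ∷ as)) ∎
    where
    open ≡-Reasoning
    N = a ℕ.* x
    leading = inv! (suc m) * toℚ x ^ suc m * monoEval (a ∷ as) (leadExp (suc m))
    rest = inv! m * liftPoly (leadExp m) p (x , a ∷ as)

g-expansion : ∀ m → Σ[ f ∈ (ℕ × Vec ℕ m → ℚ) ] Expansion m f
g-expansion zero    = (λ _ → 0ℚ) , span-0 , λ { x [] → refl }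
g-expansion (suc m) =
  let (p , p∈ , p-eq) = faulhaber m
      (f , f-expansion) = g-expansion m
  in _ , expansion-suc p∈ p-eq f-expansion

lincomb-monomial-1 : ∀ {m} (a : Vec ℕ m) T → lincomb (λ E → monomial E (1 , a)) T ≡ evalPoly T a
lincomb-monomial-1 a []            = refl
lincomb-monomial-1 a ((c , E) ∷ T) =
  cong₂ (λ u v → c * u + v)
        (trans (cong (_* monoEval a E) (toℚ1^k≡1 (xdeg E))) (ℚP.*-identityˡ (monoEval a E)))
        (lincomb-monomial-1 a T)

lemma2p21 : (n : ℕ) (1≤n : 1 ≤ n) →
    Σ (List (Term n)) λ Q →
      All (λ t → deg (proj₂ t) < deg (leadExp n) × lookup (proj₂ t) (fromℕ< 1≤n) < n) Q ×
      ((a : Vec ℕ n) → toℚ (h a) ≡ inv! n * monoEval a (leadExp n) + evalPoly Q a)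
lemma2p21 n@(suc _) (s≤s z≤n) =
  let (f , (T , T∈ , f≗T) , g-eq) = g-expansion n
      open ≡-Reasoning
  in
  T , All.map (λ { {_ , _ ∷ _} (e<n , deg<) → deg< , e<n }) T∈ , λ a → begin
    toℚ (h a)
      ≡⟨ g-eq 1 a ⟩
    inv! n * toℚ 1 ^ n * monoEval a (leadExp n) + f (1 , a)
      ≡⟨ cong₂ (λ u v → inv! n * u * monoEval a (leadExp n) + v) (toℚ1^k≡1 n) (f≗T (1 , a)) ⟩
    inv! n * 1ℚ * monoEval a (leadExp n) + lincomb (λ E → monomial E (1 , a)) T
      ≡⟨ cong₂ (λ u v → u * monoEval a (leadExp n) + v) (ℚP.*-identityʳ (inv! n)) (lincomb-monomial-1 a T) ⟩
    inv! n * monoEval a (leadExp n) + evalPoly T a ∎
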